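{- Let $\pi$ be a partition of $[n]$ with blocks $A,B\in\pi$ such that $A$ and $B$ cross each other and every other pair of distinct blocks of $\pi$ is non-crossing. Then for every non-crossing partition $\rho$ of $A\cup B$, the partition $\rho\cup\pi|_{[n]\setminus(A\cup B)}$ of $[n]$ is non-crossing.
   Context: $[n]=\{1,\dots,n\}$ with its natural order. Two blocks $C,D$ of a partition are crossing if there are $c_1,c_2\in C$, $d_1,d_2\in D$ with $c_1<d_1<c_2<d_2$ or $d_1<c_1<d_2<c_2$; a partition (of any subset of $[n]$) is non-crossing if no two of its blocks cross. For $S\subseteq[n]$, $\pi|_S=\{P\cap S: P\in\pi, P\cap S\neq\emptyset\}$; here $\pi|_{[n]\setminus(A\cup B)}$ consists of the blocks of $\pi$ other than $A$ and $B$. -}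

module Defs where

open import Data.Nat using (ℕ)
open import Data.Fin using (Fin; _<_)
open import Data.Fin.Subset using (Subset; _∈_; _∩_; Nonempty)
open import Data.Fin.Subset.Properties using (nonempty?)
open import Data.List using (List; length; lookup; map; filter)
open import Data.Product using (∃; _×_; Σ)
open import Data.Sum using (_⊎_)
open import Relation.Binary.PropositionalEquality using (_≢_)
open import Relation.Nullary using (¬_)
open import Relation.Nullary.Decidable using (¬?)
open import Function.Bundles using (_⇔_)

-- Ground set [n] is modelled by Fin n = {0,…,n-1} with its natural order
-- (order-isomorphic to {1,…,n}).  A block is a subset of Fin n.

Crosses : ∀ {n} → Subset n → Subset n → Set
Crosses {n} C D =
  ∃ λ (c₁ : Fin n) → ∃ λ (c₂ : Fin n) → ∃ λ (d₁ : Fin n) → ∃ λ (d₂ : Fin n) →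
    c₁ ∈ C × c₂ ∈ C × d₁ ∈ D × d₂ ∈ D ×
    ((c₁ < d₁ × d₁ < c₂ × c₂ < d₂) ⊎ (d₁ < c₁ × c₁ < d₂ × d₂ < c₂))

NonCrossing : ∀ {n} → List (Subset n) → Set
NonCrossing bs =
  ∀ (k l : Fin (length bs)) → k ≢ l → ¬ Crosses (lookup bs k) (lookup bs l)

IsPartitionOf : ∀ {n} → Subset n → List (Subset n) → Set
IsPartitionOf {n} S bs =
  (∀ (k : Fin (length bs)) → Nonempty (lookup bs k)) ×
  (∀ (k l : Fin (length bs)) → k ≢ l → ∀ (x : Fin n) →
      x ∈ lookup bs k → ¬ (x ∈ lookup bs l)) ×
  (∀ (x : Fin n) → (x ∈ S) ⇔ (∃ λ (k : Fin (length bs)) → x ∈ lookup bs k))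

restrict : ∀ {n} → List (Subset n) → Subset n → List (Subset n)
restrict bs S = filter (λ P → nonempty? P) (map (λ P → P ∩ S) bs)

{-# OPTIONS --safe #-}
module Submission where

open import Defs
open import Data.Nat using (ℕ)
open import Data.Fin using (Fin)
open import Data.Fin.Subset using (Subset; _∪_; ∁; ⊤)
open import Data.List using (List; length; lookup; _++_)
open import Data.Product using (_×_)
open import Data.Sum using (_⊎_)
open import Relation.Binary.PropositionalEquality using (_≡_; _≢_)
open import Relation.Nullary using (¬_)

open import Data.Fin using (zero; suc; _<_)
open import Data.Fin.Subset using (_∈_; _⊆_; _∩_; Nonempty)
open import Data.Fin.Subset.Properties using (p∩q⊆p; p∩q⊆q; x∈p∪q⁻; x∈p∪q⁺; x∈∁p⇒x∉p)
import Data.Nat.Properties as ℕ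
open import Data.List.Properties using (tabulate-lookup)
open import Data.List.Membership.Propositional.Properties using (∈-lookup)
open import Data.List.Relation.Unary.All as All using (All)
import Data.List.Relation.Unary.All.Properties as All
open import Data.List.Relation.Unary.AllPairs as AllPairs using (AllPairs; _∷_)
import Data.List.Relation.Unary.AllPairs.Properties as AllPairs
open import Data.Product using (_,_)
open import Data.Sum using (inj₁; inj₂)
open import Function using (_∘_)
open import Function.Bundles using (Equivalence)
open import Level using (Level)
open import Relation.Binary.Core using (Rel)
open import Relation.Binary.Definitions using (Symmetric)
open import Relation.Binary.PropositionalEquality using (refl; cong; subst)
open import Relation.Nullary using (contradiction)

private
  variable
    m : ℕ
    a ℓ : Level
    X : Set a
    C D P Q R : Subset m
    c c′ : Fin m

crosses-sym : Crosses C D → Crosses D C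
crosses-sym (c₁ , c₂ , d₁ , d₂ , c₁∈ , c₂∈ , d₁∈ , d₂∈ , inj₁ order) =
  d₁ , d₂ , c₁ , c₂ , d₁∈ , d₂∈ , c₁∈ , c₂∈ , inj₂ order
crosses-sym (c₁ , c₂ , d₁ , d₂ , c₁∈ , c₂∈ , d₁∈ , d₂∈ , inj₂ order) =
  d₁ , d₂ , c₁ , c₂ , d₁∈ , d₂∈ , c₁∈ , c₂∈ , inj₁ order

crosses-mono : C ⊆ P → D ⊆ Q → Crosses C D → Crosses P Q
crosses-mono C⊆P D⊆Q (c₁ , c₂ , d₁ , d₂ , c₁∈ , c₂∈ , d₁∈ , d₂∈ , order) =
  c₁ , c₂ , d₁ , d₂ , C⊆P c₁∈ , C⊆P c₂∈ , D⊆Q d₁∈ , D⊆Q d₂∈ , order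

crosses⇒nonempty : Crosses C D → Nonempty C
crosses⇒nonempty (c₁ , _ , _ , _ , c₁∈ , _) = c₁ , c₁∈

Between : Fin m → Fin m → Fin m → Set
Between c c′ x = c < x × x < c′

Outside : Fin m → Fin m → Fin m → Set
Outside c c′ x = x < c ⊎ c′ < x

data Straddles (C D : Subset m) : Set where
  straddle : ∀ {c c′ d d′} → c ∈ C → c′ ∈ C → d ∈ D → d′ ∈ D →
             Between c c′ d → Outside c c′ d′ → Straddles C D

crosses⇒straddles : Crosses C D → Straddles C D
crosses⇒straddles (_ , _ , _ , _ , c₁∈ , c₂∈ , d₁∈ , d₂∈ , inj₁ (c₁<d₁ , d₁<c₂ , c₂<d₂)) =
  straddle c₁∈ c₂∈ d₁∈ d₂∈ (c₁<d₁ , d₁<c₂) (inj₂ c₂<d₂)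
crosses⇒straddles (_ , _ , _ , _ , c₁∈ , c₂∈ , d₁∈ , d₂∈ , inj₂ (d₁<c₁ , c₁<d₂ , d₂<c₂)) =
  straddle c₁∈ c₂∈ d₂∈ d₁∈ (c₁<d₂ , d₂<c₂) (inj₁ d₁<c₁)

straddles⇒crosses : Straddles C D → Crosses C D
straddles⇒crosses (straddle c∈ c′∈ d∈ d′∈ (c<d , d<c′) (inj₁ d′<c)) =
  _ , _ , _ , _ , c∈ , c′∈ , d′∈ , d∈ , inj₂ (d′<c , c<d , d<c′)
straddles⇒crosses (straddle c∈ c′∈ d∈ d′∈ (c<d , d<c′) (inj₂ c′<d′)) =
  _ , _ , _ , _ , c∈ , c′∈ , d∈ , d′∈ , inj₁ (c<d , d<c′ , c′<d′)

-- Not crossing C, P lies within [c, c′] and Q avoids (c, c′); but a point of Q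
-- between two points of P would lie in (c, c′).
separation : ¬ Crosses C P → ¬ Crosses C Q → c ∈ C → c′ ∈ C →
             ∀ {p q} → p ∈ P → Between c c′ p → q ∈ Q → Outside c c′ q → ¬ Crosses P Q
separation {P = P} {c = c} {c′ = c′} ¬C×P ¬C×Q c∈ c′∈ p∈ p-between q∈ q-outside P×Q
  with crosses⇒straddles P×Q
... | straddle {c = p₁} {c′ = p₂} {d = q′} p₁∈ p₂∈ q′∈ _ (p₁<q′ , q′<p₂) _ =
  ¬C×Q (straddles⇒crosses (straddle c∈ c′∈ q′∈ q∈ (c<q′ , q′<c′) q-outside))
  where
  P-confined : ∀ {x} → x ∈ P → ¬ Outside c c′ x
  P-confined x∈ x-outside = ¬C×P (straddles⇒crosses (straddle c∈ c′∈ p∈ x∈ p-between x-outside))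
  c<q′ : c < q′
  c<q′ = ℕ.≤-<-trans (ℕ.≮⇒≥ (P-confined p₁∈ ∘ inj₁)) p₁<q′
  q′<c′ : q′ < c′
  q′<c′ = ℕ.<-≤-trans q′<p₂ (ℕ.≮⇒≥ (P-confined p₂∈ ∘ inj₂))

-- As C crosses neither A nor B, each of them lies in a single gap of C; since A
-- and B cross, it is the same gap, and it then contains all of R ⊆ A ∪ B.
¬crosses-⊆∪ : {A B : Subset m} → Crosses A B → ¬ Crosses C A → ¬ Crosses C B → R ⊆ A ∪ B → ¬ Crosses C R
¬crosses-⊆∪ {A = A} {B = B} A×B ¬C×A ¬C×B R⊆A∪B C×R with crosses⇒straddles C×R
... | straddle c∈ c′∈ r∈ r′∈ r-between r′-outside
  with x∈p∪q⁻ A B (R⊆A∪B r∈) | x∈p∪q⁻ A B (R⊆A∪B r′∈)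
... | inj₁ r∈A | inj₁ r′∈A = ¬C×A (straddles⇒crosses (straddle c∈ c′∈ r∈A r′∈A r-between r′-outside))
... | inj₂ r∈B | inj₂ r′∈B = ¬C×B (straddles⇒crosses (straddle c∈ c′∈ r∈B r′∈B r-between r′-outside))
... | inj₁ r∈A | inj₂ r′∈B = separation ¬C×A ¬C×B c∈ c′∈ r∈A r-between r′∈B r′-outside A×B
... | inj₂ r∈B | inj₁ r′∈A =
  separation ¬C×B ¬C×A c∈ c′∈ r∈B r-between r′∈A r′-outside (crosses-sym A×B)

lookup⇒All : {P : X → Set ℓ} (xs : List X) → (∀ k → P (lookup xs k)) → All P xs
lookup⇒All {P = P} xs Pxs = subst (All P) (tabulate-lookup xs) (All.tabulate⁺ Pxs)

lookup≢⇒AllPairs : {R : Rel X ℓ} (xs : List X) →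
  (∀ k l → k ≢ l → R (lookup xs k) (lookup xs l)) → AllPairs R xs
lookup≢⇒AllPairs {R = R} xs Rxs =
  subst (AllPairs R) (tabulate-lookup xs) (AllPairs.tabulate⁺ (Rxs _ _))

AllPairs⇒lookup≢ : {R : Rel X ℓ} {xs : List X} → Symmetric R → AllPairs R xs →
  ∀ k l → k ≢ l → R (lookup xs k) (lookup xs l)
AllPairs⇒lookup≢ _   (_ ∷ _)   zero    zero    0≢0 = contradiction refl 0≢0
AllPairs⇒lookup≢ _   (Rx ∷ _)  zero    (suc l) _   = All.lookup Rx (∈-lookup l)
AllPairs⇒lookup≢ sym (Rx ∷ _)  (suc k) zero    _   = sym (All.lookup Rx (∈-lookup k))
AllPairs⇒lookup≢ sym (_ ∷ Rxs) (suc k) (suc l) k≢l = AllPairs⇒lookup≢ sym Rxs k l (k≢l ∘ cong suc)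

NonCrossingPair : Rel (Subset m) _
NonCrossingPair C D = ¬ Crosses C D

isPartitionOf⇒lookup⊆ : ∀ {S : Subset m} bs → IsPartitionOf S bs → ∀ k → lookup bs k ⊆ S
isPartitionOf⇒lookup⊆ _ (_ , _ , covers) k x∈ = Equivalence.from (covers _) (k , x∈)

lemma23 : ∀ (n : ℕ) (π : List (Subset n)) (i j : Fin (length π)) →
    IsPartitionOf ⊤ π →
    i ≢ j →
    Crosses (lookup π i) (lookup π j) →
    (∀ (k l : Fin (length π)) → k ≢ l →
    ¬ ((k ≡ i × l ≡ j) ⊎ (k ≡ j × l ≡ i)) →
    ¬ Crosses (lookup π k) (lookup π l)) →
    ∀ (ρ : List (Subset n)) →
    IsPartitionOf (lookup π i ∪ lookup π j) ρ →
    NonCrossing ρ →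
    NonCrossing (ρ ++ restrict π (∁ (lookup π i ∪ lookup π j)))
lemma23 n π i j _ _ A×B others ρ ρ-partition ρ-nc =
  AllPairs⇒lookup≢ (_∘ crosses-sym)
    (AllPairs.++⁺ (lookup≢⇒AllPairs ρ ρ-nc) rest-nc ρ-vs-rest)
  where
  A B S : Subset n
  A = lookup π i
  B = lookup π j
  S = ∁ (A ∪ B)

  meets-S⇒≢ : ∀ {t} → Nonempty (lookup π t ∩ S) → t ≢ i × t ≢ j
  meets-S⇒≢ {t} (x , x∈) =
    (λ { refl → x∈∁p⇒x∉p (p∩q⊆q A S x∈) (x∈p∪q⁺ (inj₁ (p∩q⊆p A S x∈))) }) ,
    (λ { refl → x∈∁p⇒x∉p (p∩q⊆q B S x∈) (x∈p∪q⁺ (inj₂ (p∩q⊆p B S x∈))) })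

  ¬others : ∀ {k l} → k ≢ i → k ≢ j → ¬ ((k ≡ i × l ≡ j) ⊎ (k ≡ j × l ≡ i))
  ¬others k≢i _   (inj₁ (k≡i , _)) = k≢i k≡i
  ¬others _   k≢j (inj₂ (k≡j , _)) = k≢j k≡j

  rest-nc : AllPairs NonCrossingPair (restrict π S)
  rest-nc = AllPairs.filter⁺ _ (AllPairs.map⁺ (lookup≢⇒AllPairs π λ k l k≢l k×l →
    let k≢i , k≢j = meets-S⇒≢ (crosses⇒nonempty k×l) in
    others k l k≢l (¬others k≢i k≢j) (crosses-mono (p∩q⊆p _ S) (p∩q⊆p _ S) k×l)))

  ρ-vs-rest : All (λ R → All (NonCrossingPair R) (restrict π S)) ρ
  ρ-vs-rest = lookup⇒All ρ λ k → All.filter⁺ _ (All.map⁺ (lookup⇒All π λ t k×t →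
    let t≢i , t≢j = meets-S⇒≢ (crosses⇒nonempty (crosses-sym k×t)) in
    ¬crosses-⊆∪ A×B (others t i t≢i (¬others t≢i t≢j)) (others t j t≢j (¬others t≢i t≢j))
      (isPartitionOf⇒lookup⊆ ρ ρ-partition k)
      (crosses-sym (crosses-mono (λ x∈ → x∈) (p∩q⊆p _ S) k×t))))
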